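{- For every $n\ge1$, the number of permutations in $\mathfrak S_n$ avoiding the generalized patterns $2\text{ - }1\text{ - }3$ and $34\text{ - }21$ is $(n-1)2^{n-2}+1$.
   Context: $\mathfrak S_n$ is the set of permutations $\pi=\pi_1\cdots\pi_n$ of $\{1,\dots,n\}$. $\pi$ avoids $2\text{ - }1\text{ - }3$ if there are no $i<j<k$ with $\pi_j<\pi_i<\pi_k$; $\pi$ avoids $34\text{ - }21$ if there are no $i$ and $k>i+1$ with $\pi_{k+1}<\pi_k<\pi_i<\pi_{i+1}$. -}

module Defs where

open import Data.Nat using (ℕ; zero; suc)
open import Data.Fin using (Fin; toℕ; _<_)
open import Data.Fin.Properties using (all?; _≟_; _<?_)
open import Data.Nat.Properties as ℕP using ()
open import Data.Vec using (Vec; []; _∷_; lookup)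
open import Data.List using (List; []; _∷_; [_]; map; concatMap; filter; length; allFin)
open import Data.Product using (_×_; _,_)
open import Relation.Nullary using (¬_; Dec; _×-dec_; _→-dec_; ¬?)
open import Relation.Binary.PropositionalEquality using (_≡_)
import Data.Nat as ℕ

-- A word π = π₁⋯πₙ over {1,…,n} is represented as a vector of length n with
-- entries in Fin n (values shifted down by one; positions are 0-based).
Word : ℕ → Set
Word n = Vec (Fin n) n

-- π is a permutation of {1,…,n}: injective (hence bijective, being an
-- endomap of a finite set).
IsPerm : ∀ {n} → Word n → Set
IsPerm {n} w = ∀ (i j : Fin n) → lookup w i ≡ lookup w j → i ≡ j

Avoids-2-1-3 : ∀ {n} → Word n → Set
Avoids-2-1-3 {n} w = ∀ (i j k : Fin n) → i < j → j < k →
  ¬ (lookup w j < lookup w i × lookup w i < lookup w k)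

Avoids-34-21 : ∀ {n} → Word n → Set
Avoids-34-21 {n} w = ∀ (i i' k k' : Fin n) →
  toℕ i' ≡ suc (toℕ i) → toℕ k' ≡ suc (toℕ k) → suc (toℕ i) ℕ.< toℕ k →
  ¬ (lookup w k' < lookup w k × lookup w k < lookup w i × lookup w i < lookup w i')

isPerm? : ∀ {n} (w : Word n) → Dec (IsPerm w)
isPerm? w = all? λ i → all? λ j → (lookup w i ≟ lookup w j) →-dec (i ≟ j)

avoids-2-1-3? : ∀ {n} (w : Word n) → Dec (Avoids-2-1-3 w)
avoids-2-1-3? w = all? λ i → all? λ j → all? λ k →
  (i <? j) →-dec ((j <? k) →-dec
    ¬? ((lookup w j <? lookup w i) ×-dec (lookup w i <? lookup w k)))

avoids-34-21? : ∀ {n} (w : Word n) → Dec (Avoids-34-21 w)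
avoids-34-21? w = all? λ i → all? λ i' → all? λ k → all? λ k' →
  (toℕ i' ℕ.≟ suc (toℕ i)) →-dec ((toℕ k' ℕ.≟ suc (toℕ k)) →-dec
    ((suc (toℕ i) ℕ.<? toℕ k) →-dec
      ¬? ((lookup w k' <? lookup w k) ×-dec
          ((lookup w k <? lookup w i) ×-dec (lookup w i <? lookup w i')))))

allVecs : (n m : ℕ) → List (Vec (Fin n) m)
allVecs n zero = [ [] ]
allVecs n (suc m) = concatMap (λ x → map (x ∷_) (allVecs n m)) (allFin n)

Av-2-1-3-34-21 : (n : ℕ) → List (Word n)
Av-2-1-3-34-21 n =
  filter (λ w → isPerm? w ×-dec (avoids-2-1-3? w ×-dec avoids-34-21? w)) (allVecs n n)

module Submission where

-- Shape of an avoider of the values [lo, lo+m): its first letter x is the minimum, the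
-- maximum, or an interior value.  In the interior case every value above x comes before
-- every value below x (otherwise x would be the "2" of a 2-1-3); each of the values above
-- x is the least or the greatest one still unused, and the values below x follow in
-- increasing order (otherwise a 34-21 would occur).  The 0/1-valued indicators
-- `ascending`, `minMax` and `good` read this description letter by letter.

open import Defs
open import Data.Nat using (ℕ; zero; suc; _+_; _*_; _∸_; _^_; _≥_; _≤_; _<_; z≤n; s≤s; z<s; _≟_; _<?_)
open import Data.Nat.Properties
open import Algebra.Properties.CommutativeSemigroup +-commutativeSemigroup using (interchange)
open import Data.Nat.ListAction using (sum)
open import Data.Nat.ListAction.Properties using (sum-++)
open import Data.Bool using (Bool; true; false; if_then_else_)
open import Data.Fin as Fin using (Fin; toℕ)
import Data.Fin.Properties as FinP
open import Data.Vec as Vec using (Vec; []; _∷_; toList; lookup)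
open import Data.List using (List; []; _∷_; length; map; concatMap; allFin; tabulate; filter)
open import Data.List.Properties using (map-++; map-∘; map-cong; map-tabulate)
open import Data.Product using (_×_; _,_; proj₁; proj₂; ∃; ∃₂)
open import Data.Sum using (_⊎_; inj₁; inj₂)
open import Data.Unit using (⊤; tt)
open import Data.Empty using (⊥; ⊥-elim)
open import Data.List.Relation.Unary.All as All using (All; []; _∷_)
open import Data.List.Relation.Unary.Unique.Propositional using (Unique)
open import Data.List.Relation.Unary.AllPairs as AllPairs using ([]; _∷_)
open import Data.List.Relation.Unary.Any as Any using (here; there)
open import Data.List.Membership.Propositional using (_∈_)
open import Relation.Binary.Definitions using (Tri; tri<; tri≈; tri>)
open import Function using (_∘_; id; case_of_)
open import Relation.Nullary using (¬_; Dec; yes; no; does; _×-dec_)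
open import Relation.Nullary.Decidable using (dec-true; dec-false)
open import Relation.Binary.PropositionalEquality
  using (_≡_; _≢_; ≢-sym; refl; sym; trans; cong; cong₂; subst; module ≡-Reasoning)

Σ< : ℕ → (ℕ → ℕ) → ℕ
Σ< zero    g = 0
Σ< (suc n) g = g 0 + Σ< n (g ∘ suc)

Σ<-cong : ∀ n {f g : ℕ → ℕ} → (∀ t → t < n → f t ≡ g t) → Σ< n f ≡ Σ< n g
Σ<-cong zero    eq = refl
Σ<-cong (suc n) eq = cong₂ _+_ (eq 0 z<s) (Σ<-cong n (λ t t<n → eq (suc t) (s≤s t<n)))

Σ<-zero : ∀ n {g : ℕ → ℕ} → (∀ t → t < n → g t ≡ 0) → Σ< n g ≡ 0
Σ<-zero zero    vanish = refl
Σ<-zero (suc n) vanish rewrite vanish 0 z<s = Σ<-zero n (λ t t<n → vanish (suc t) (s≤s t<n))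

Σ<-+ : ∀ n (f g : ℕ → ℕ) → Σ< n (λ t → f t + g t) ≡ Σ< n f + Σ< n g
Σ<-+ zero    f g = refl
Σ<-+ (suc n) f g rewrite Σ<-+ n (f ∘ suc) (g ∘ suc) = interchange (f 0) (g 0) _ _

Σ<-point : ∀ {n} c X → c < n → Σ< n (λ t → if does (t ≟ c) then X else 0) ≡ X
Σ<-point {suc n} zero    X _         = trans (cong (X +_) (Σ<-zero n (λ _ _ → refl))) (+-identityʳ X)
Σ<-point {suc n} (suc c) X (s≤s c<n) = Σ<-point c X c<n

Σ<-truncate : ∀ {n m} (g : ℕ → ℕ) → m ≤ n → (∀ t → m ≤ t → g t ≡ 0) → Σ< n g ≡ Σ< m g
Σ<-truncate {n} {zero}  g _         vanish = Σ<-zero n (λ t _ → vanish t z≤n)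
Σ<-truncate {suc n} {suc m} g (s≤s m≤n) vanish =
  cong (g 0 +_) (Σ<-truncate (g ∘ suc) m≤n (λ t m≤t → vanish (suc t) (s≤s m≤t)))

Σ<-window : ∀ {n} lo {m} (g : ℕ → ℕ) → lo + m ≤ n →
  (∀ t → t < lo → g t ≡ 0) → (∀ t → lo + m ≤ t → g t ≡ 0) → Σ< n g ≡ Σ< m (λ i → g (lo + i))
Σ<-window zero      g lo+m≤n below above = Σ<-truncate g lo+m≤n above
Σ<-window {suc n} (suc lo) g (s≤s lo+m≤n) below above rewrite below 0 z<s =
  Σ<-window lo (g ∘ suc) lo+m≤n (λ t t<lo → below (suc t) (s≤s t<lo)) (λ t le → above (suc t) (s≤s le))

values : ∀ {n k} → Vec (Fin n) k → List ℕ
values = toList ∘ Vec.map toℕ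

opaque
  Count : (n k : ℕ) → (List ℕ → ℕ) → ℕ
  Count n k f = sum (map (f ∘ values) (allVecs n k))

  Count-cons : ∀ {n} k (f : List ℕ → ℕ) → Count n (suc k) f ≡ Σ< n (λ t → Count n k (f ∘ (t ∷_)))
  Count-cons {n} k f = begin
    sum (map (f ∘ values) (concatMap (λ x → map (x ∷_) (allVecs n k)) (allFin n)))
      ≡⟨ sum-concatMap (allFin n) ⟩
    sum (map (λ x → sum (map (f ∘ values) (map (x ∷_) (allVecs n k)))) (allFin n))
      ≡⟨ cong sum (map-cong (λ x → cong sum (sym (map-∘ (allVecs n k)))) (allFin n)) ⟩
    sum (map (λ x → Count n k (f ∘ (toℕ x ∷_))) (allFin n))
      ≡⟨ sum-allFin n (λ t → Count n k (f ∘ (t ∷_))) ⟩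
    Σ< n (λ t → Count n k (f ∘ (t ∷_))) ∎
    where
    open ≡-Reasoning
    sum-concatMap : ∀ {A B : Set} {g : B → ℕ} {h : A → List B} xs →
      sum (map g (concatMap h xs)) ≡ sum (map (λ x → sum (map g (h x))) xs)
    sum-concatMap []       = refl
    sum-concatMap {g = g} {h} (x ∷ xs) =
      trans (cong sum (map-++ g (h x) (concatMap h xs)))
            (trans (sum-++ (map g (h x)) _) (cong (sum (map g (h x)) +_) (sum-concatMap xs)))
    sum-allFin : ∀ m (F : ℕ → ℕ) → sum (map (F ∘ toℕ) (allFin m)) ≡ Σ< m F
    sum-allFin zero    F = refl
    sum-allFin (suc m) F = cong (F 0 +_) (begin
      sum (map (F ∘ toℕ) (tabulate {n = m} Fin.suc))  ≡⟨ cong sum (map-tabulate {n = m} Fin.suc (F ∘ toℕ)) ⟩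
      sum (tabulate {n = m} (F ∘ suc ∘ toℕ))  ≡⟨ cong sum (sym (map-tabulate {n = m} id (F ∘ suc ∘ toℕ))) ⟩
      sum (map (F ∘ suc ∘ toℕ) (allFin m))    ≡⟨ sum-allFin m (F ∘ suc) ⟩
      Σ< m (F ∘ suc)                          ∎)
  
  Count-zero : ∀ {n} k → Count n k (λ _ → 0) ≡ 0
  Count-zero {n} k = go (allVecs n k)
    where
    go : ∀ (vs : List (Vec (Fin n) k)) → sum (map (λ _ → 0) vs) ≡ 0
    go []       = refl
    go (_ ∷ vs) = go vs

  length-filter-Count : ∀ {n k} {P : Vec (Fin n) k → Set} (P? : ∀ v → Dec (P v)) (f : List ℕ → ℕ) →
    (∀ v → (if does (P? v) then 1 else 0) ≡ f (values v)) → length (filter P? (allVecs n k)) ≡ Count n k f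
  length-filter-Count {n} {k} P? f indicator = go (allVecs n k)
    where
    go : ∀ vs → length (filter P? vs) ≡ sum (map (f ∘ values) vs)
    go []       = refl
    go (v ∷ vs) rewrite sym (indicator v) with does (P? v)
    ... | true  = cong suc (go vs)
    ... | false = go vs

  Count-nil : ∀ {n} (f : List ℕ → ℕ) → Count n 0 f ≡ f []
  Count-nil f = +-identityʳ (f [])

Count-dec : ∀ {n} k {P : Set} (P? : Dec P) {f g : List ℕ → ℕ} {r s : ℕ} →
  (P → Count n k f ≡ r) → (¬ P → Count n k g ≡ s) →
  Count n k (λ w → if does (P?) then f w else g w) ≡ (if does (P?) then r else s)
Count-dec k (yes p) hf hg = hf p
Count-dec k (no ¬p) hf hg = hg ¬p

ascending : ℕ → ℕ → List ℕ → ℕ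
ascending lo zero    []      = 1
ascending lo zero    (_ ∷ _) = 0
ascending lo (suc q) []      = 0
ascending lo (suc q) (t ∷ w) = if does (t ≟ lo) then ascending (suc lo) q w else 0

-- Indicator that w first lists the upper block [a, a+p), every letter being the least or
-- the greatest value of the block not used yet, and then the lower block [lo, lo+q)
-- in increasing order.
minMax : ℕ → ℕ → ℕ → ℕ → List ℕ → ℕ
minMax a zero          lo q w       = ascending lo q w
minMax a (suc p)       lo q []      = 0
minMax a (suc zero)    lo q (t ∷ w) = if does (t ≟ a) then minMax (suc a) zero lo q w else 0
minMax a (suc (suc p)) lo q (t ∷ w) =
  if does (t ≟ a) then minMax (suc a) (suc p) lo q w
  else if does (t ≟ a + suc p) then minMax a (suc p) lo q w
  else 0

-- Indicator of the avoiders of 2-1-3 and 34-21 among the arrangements of the window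
-- [lo, lo+m): the first letter is the minimum, the maximum, or an interior value t, and in
-- the last case the rest is the min/max sequence of the values above t followed by the
-- values below t in increasing order.
good : ℕ → ℕ → List ℕ → ℕ
good lo zero    []      = 1
good lo zero    (_ ∷ _) = 0
good lo (suc m) []      = 0
good lo (suc m) (t ∷ w) =
  if does (t ≟ lo) then good (suc lo) m w
  else if does (t ≟ lo + m) then good lo m w
  else if does (lo <? t ×-dec t <? lo + m) then minMax (suc t) (lo + m ∸ t) lo (t ∸ lo) w
  else 0

dec-as-sum : ∀ {P : Set} (P? : Dec P) {X Y : ℕ} → (P → Y ≡ 0) →
  (if does P? then X else Y) ≡ (if does P? then X else 0) + Y
dec-as-sum (yes p) {X} vanish = trans (sym (+-identityʳ X)) (cong (X +_) (sym (vanish p)))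
dec-as-sum (no _)          _  = refl

dec-else : ∀ {P : Set} (P? : Dec P) {X Y Y′ : ℕ} → (¬ P → Y ≡ Y′) →
  (if does P? then X else Y) ≡ (if does P? then X else Y′)
dec-else (yes _) _  = refl
dec-else (no ¬p) eq = eq ¬p

minMaxCount : ℕ → ℕ
minMaxCount p = 2 ^ (p ∸ 1)

-- interior j = 2^(j-1) + ⋯ + 2 + 1: the contribution of the j interior first letters of a
-- window of j+2 values, each followed by a min/max sequence of the values above it.
interior : ℕ → ℕ
interior j = Σ< j (λ i → minMaxCount (j ∸ i))

avoiders : ℕ → ℕ
avoiders zero          = 1
avoiders (suc zero)    = 1
avoiders (suc (suc k)) = avoiders (suc k) + avoiders (suc k) + interior k

count-ascending : ∀ {n} lo q → lo + q ≤ n → Count n q (ascending lo q) ≡ 1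
count-ascending lo zero _ = Count-nil _
count-ascending {n} lo (suc q) lo+q<n = begin
  Count n (suc q) (ascending lo (suc q))           ≡⟨ Count-cons q _ ⟩
  Σ< n (λ t → Count n q (ascending lo (suc q) ∘ (t ∷_)))
    ≡⟨ Σ<-cong n (λ t _ → Count-dec q (t ≟ lo) (λ _ → count-ascending (suc lo) q lo+q<n′) (λ _ → Count-zero q)) ⟩
  Σ< n (λ t → if does (t ≟ lo) then 1 else 0)     ≡⟨ Σ<-point lo 1 (≤-trans (s≤s (m≤m+n lo q)) lo+q<n′) ⟩
  1                                                ∎
  where
  open ≡-Reasoning
  lo+q<n′ : suc lo + q ≤ n
  lo+q<n′ = subst (_≤ n) (+-suc lo q) lo+q<n

-- Each letter of the upper block but the last has two choices, hence 2^(p-1) min/max sequences.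
count-minMax : ∀ {n} a p lo q → a + p ≤ n → lo + q ≤ n → Count n (p + q) (minMax a p lo q) ≡ minMaxCount p
count-minMax a zero lo q _ lo+q≤n = count-ascending lo q lo+q≤n
count-minMax {n} a (suc zero) lo q a+1≤n lo+q≤n = begin
  Count n (suc q) (minMax a 1 lo q)                  ≡⟨ Count-cons q _ ⟩
  Σ< n (λ t → Count n q (minMax a 1 lo q ∘ (t ∷_)))
    ≡⟨ Σ<-cong n (λ t _ → Count-dec q (t ≟ a) (λ _ → count-ascending lo q lo+q≤n) (λ _ → Count-zero q)) ⟩
  Σ< n (λ t → if does (t ≟ a) then 1 else 0)        ≡⟨ Σ<-point a 1 (subst (_≤ n) (+-comm a 1) a+1≤n) ⟩
  1                                                   ∎
  where open ≡-Reasoning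
count-minMax {n} a (suc (suc p)) lo q a+p+2≤n lo+q≤n = begin
  Count n (suc (suc p) + q) (minMax a (suc (suc p)) lo q)         ≡⟨ Count-cons (suc p + q) _ ⟩
  Σ< n (λ t → Count n (suc p + q) (minMax a (suc (suc p)) lo q ∘ (t ∷_)))
    ≡⟨ Σ<-cong n (λ t _ → Count-dec _ (t ≟ a) (λ _ → count-minMax (suc a) (suc p) lo q a+p+2≤n′ lo+q≤n)
                            (λ _ → Count-dec _ (t ≟ a + suc p) (λ _ → count-minMax a (suc p) lo q a+p+1≤n lo+q≤n)
                                     (λ _ → Count-zero _))) ⟩
  Σ< n (λ t → if does (t ≟ a) then M else if does (t ≟ a + suc p) then M else 0)
    ≡⟨ Σ<-cong n (λ t _ → dec-as-sum (t ≟ a) (λ { refl → max-not-min })) ⟩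
  Σ< n (λ t → (if does (t ≟ a) then M else 0) + (if does (t ≟ a + suc p) then M else 0))
    ≡⟨ Σ<-+ n _ _ ⟩
  Σ< n (λ t → if does (t ≟ a) then M else 0) + Σ< n (λ t → if does (t ≟ a + suc p) then M else 0)
    ≡⟨ cong₂ _+_ (Σ<-point a M (≤-trans (s≤s (m≤m+n a (suc p))) a+p+2≤n′))
                 (Σ<-point (a + suc p) M a+p+2≤n′) ⟩
  M + M                                                           ≡⟨ cong (M +_) (sym (+-identityʳ M)) ⟩
  minMaxCount (suc (suc p))                                       ∎
  where
  open ≡-Reasoning
  M = minMaxCount (suc p)
  a+p+2≤n′ : suc a + suc p ≤ n
  a+p+2≤n′ = subst (_≤ n) (+-suc a (suc p)) a+p+2≤n
  a+p+1≤n : a + suc p ≤ n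
  a+p+1≤n = ≤-trans (+-monoʳ-≤ a (n≤1+n (suc p))) a+p+2≤n
  max-not-min : (if does (a ≟ a + suc p) then M else 0) ≡ 0
  max-not-min rewrite dec-false (a ≟ a + suc p) (λ eq → m≢1+m+n a (trans eq (+-suc a p))) = refl

split-window : ∀ {lo m t} → lo ≤ t → t ≤ lo + m → (lo + m ∸ t) + (t ∸ lo) ≡ m
split-window {lo} {m} {t} lo≤t t≤lo+m = +-cancelˡ-≡ lo _ _ (begin
  lo + ((lo + m ∸ t) + (t ∸ lo))  ≡⟨ cong (lo +_) (+-comm (lo + m ∸ t) (t ∸ lo)) ⟩
  lo + ((t ∸ lo) + (lo + m ∸ t))  ≡⟨ sym (+-assoc lo (t ∸ lo) _) ⟩
  (lo + (t ∸ lo)) + (lo + m ∸ t)  ≡⟨ cong (_+ (lo + m ∸ t)) (m+[n∸m]≡n lo≤t) ⟩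
  t + (lo + m ∸ t)                ≡⟨ m+[n∸m]≡n t≤lo+m ⟩
  lo + m                          ∎)
  where open ≡-Reasoning

window-above : ∀ {lo m t} → t ≤ lo + m → suc t + (lo + m ∸ t) ≡ lo + suc m
window-above {lo} {m} t≤lo+m = trans (cong suc (m+[n∸m]≡n t≤lo+m)) (sym (+-suc lo m))

firstLetterCount : ℕ → ℕ → ℕ → ℕ
firstLetterCount lo m t =
  if does (t ≟ lo) then avoiders m
  else if does (t ≟ lo + m) then avoiders m
  else if does (lo <? t ×-dec t <? lo + m) then minMaxCount (lo + m ∸ t)
  else 0

Σ<-interior : ∀ {n} lo j → lo + suc j ≤ n →
  Σ< n (λ t → if does (lo <? t ×-dec t <? lo + suc j) then minMaxCount (lo + suc j ∸ t) else 0)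
    ≡ interior j
Σ<-interior {n} lo j lo+j<n =
  trans (Σ<-window (suc lo) _ (subst (_≤ n) (+-suc lo j) lo+j<n) below above) (Σ<-cong j inside)
  where
  below : ∀ t → t < suc lo →
    (if does (lo <? t ×-dec t <? lo + suc j) then minMaxCount (lo + suc j ∸ t) else 0) ≡ 0
  below t t≤lo rewrite dec-false (lo <? t ×-dec t <? lo + suc j) (λ (lo<t , _) → <⇒≱ lo<t (≤-pred t≤lo)) = refl
  above : ∀ t → suc lo + j ≤ t →
    (if does (lo <? t ×-dec t <? lo + suc j) then minMaxCount (lo + suc j ∸ t) else 0) ≡ 0
  above t lo+j<t rewrite dec-false (lo <? t ×-dec t <? lo + suc j)
      (λ (_ , t<lo+j) → <⇒≱ t<lo+j (subst (_≤ t) (sym (+-suc lo j)) lo+j<t)) = refl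
  inside : ∀ i → i < j →
    (if does (lo <? suc lo + i ×-dec suc lo + i <? lo + suc j) then minMaxCount (lo + suc j ∸ (suc lo + i)) else 0)
      ≡ minMaxCount (j ∸ i)
  inside i i<j rewrite dec-true (lo <? suc lo + i ×-dec suc lo + i <? lo + suc j)
      (s≤s (m≤m+n lo i) , subst (suc lo + i <_) (sym (+-suc lo j)) (s≤s (+-monoʳ-< lo i<j))) =
    cong minMaxCount (trans (cong (_∸ suc (lo + i)) (+-suc lo j)) ([m+n]∸[m+o]≡n∸o lo j i))

Σ<-firstLetterCount : ∀ {n} lo m → lo + suc m ≤ n → Σ< n (firstLetterCount lo m) ≡ avoiders (suc m)
Σ<-firstLetterCount {n} lo zero lo<n =
  trans (Σ<-cong n (λ t _ → only-min t)) (Σ<-point lo 1 (subst (_≤ n) (+-comm lo 1) lo<n))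
  where
  only-min : ∀ t → firstLetterCount lo 0 t ≡ (if does (t ≟ lo) then 1 else 0)
  only-min t = dec-else (t ≟ lo) nothing-else
    where
    nothing-else : t ≢ lo →
      (if does (t ≟ lo + 0) then 1 else if does (lo <? t ×-dec t <? lo + 0) then minMaxCount (lo + 0 ∸ t) else 0) ≡ 0
    nothing-else t≢lo rewrite dec-false (t ≟ lo + 0) (λ eq → t≢lo (trans eq (+-identityʳ lo)))
                            | dec-false (lo <? t ×-dec t <? lo + 0)
                                (λ (lo<t , t<lo) → <-asym lo<t (subst (t <_) (+-identityʳ lo) t<lo)) = refl
Σ<-firstLetterCount {n} lo (suc j) lo+j+1<n = begin
  Σ< n (firstLetterCount lo (suc j))
    ≡⟨ Σ<-cong n (λ t _ → trans (dec-as-sum (t ≟ lo) (λ { refl → rest-at-min }))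
                                (cong (atMin t +_) (dec-as-sum (t ≟ lo + suc j) (λ { refl → interior-at-max })))) ⟩
  Σ< n (λ t → atMin t + (atMax t + inside t))     ≡⟨ Σ<-+ n atMin _ ⟩
  Σ< n atMin + Σ< n (λ t → atMax t + inside t)    ≡⟨ cong (Σ< n atMin +_) (Σ<-+ n atMax inside) ⟩
  Σ< n atMin + (Σ< n atMax + Σ< n inside)
    ≡⟨ cong₂ _+_ (Σ<-point lo A (≤-trans (s≤s (m≤m+n lo (suc j))) lo+j+1<n′))
                 (cong₂ _+_ (Σ<-point (lo + suc j) A lo+j+1<n′) (Σ<-interior lo j (<⇒≤ lo+j+1<n′))) ⟩
  A + (A + interior j)                              ≡⟨ sym (+-assoc A A (interior j)) ⟩
  avoiders (suc (suc j))                            ∎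
  where
  open ≡-Reasoning
  A = avoiders (suc j)
  atMin atMax inside : ℕ → ℕ
  atMin  t = if does (t ≟ lo) then A else 0
  atMax  t = if does (t ≟ lo + suc j) then A else 0
  inside t = if does (lo <? t ×-dec t <? lo + suc j) then minMaxCount (lo + suc j ∸ t) else 0
  lo+j+1<n′ : suc (lo + suc j) ≤ n
  lo+j+1<n′ = subst (_≤ n) (+-suc lo (suc j)) lo+j+1<n
  rest-at-min : (if does (lo ≟ lo + suc j) then A else inside lo) ≡ 0
  rest-at-min rewrite dec-false (lo ≟ lo + suc j) (λ eq → m≢1+m+n lo (trans eq (+-suc lo j)))
                    | dec-false (lo <? lo ×-dec lo <? lo + suc j) (λ (lo<lo , _) → n≮n lo lo<lo) = refl
  interior-at-max : inside (lo + suc j) ≡ 0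
  interior-at-max rewrite dec-false (lo <? lo + suc j ×-dec lo + suc j <? lo + suc j)
                            (λ (_ , lt) → n≮n (lo + suc j) lt) = refl

count-good : ∀ {n} lo m → lo + m ≤ n → Count n m (good lo m) ≡ avoiders m
count-good lo zero _ = Count-nil _
count-good {n} lo (suc m) lo+m<n = begin
  Count n (suc m) (good lo (suc m))                     ≡⟨ Count-cons m _ ⟩
  Σ< n (λ t → Count n m (good lo (suc m) ∘ (t ∷_)))      ≡⟨ Σ<-cong n (λ t _ → count-first t) ⟩
  Σ< n (firstLetterCount lo m)                          ≡⟨ Σ<-firstLetterCount lo m lo+m<n ⟩
  avoiders (suc m)                                      ∎
  where
  open ≡-Reasoning
  lo+m≤n : lo + m ≤ n
  lo+m≤n = ≤-trans (+-monoʳ-≤ lo (n≤1+n m)) lo+m<n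
  count-interior : ∀ t → lo < t → t < lo + m →
    Count n m (minMax (suc t) (lo + m ∸ t) lo (t ∸ lo)) ≡ minMaxCount (lo + m ∸ t)
  count-interior t lo<t t<lo+m =
    subst (λ k → Count n k (minMax (suc t) (lo + m ∸ t) lo (t ∸ lo)) ≡ minMaxCount (lo + m ∸ t))
      (split-window (<⇒≤ lo<t) (<⇒≤ t<lo+m))
      (count-minMax (suc t) (lo + m ∸ t) lo (t ∸ lo) upper≤n lower≤n)
    where
    upper≤n : suc t + (lo + m ∸ t) ≤ n
    upper≤n = subst (_≤ n) (sym (window-above (<⇒≤ t<lo+m))) lo+m<n
    lower≤n : lo + (t ∸ lo) ≤ n
    lower≤n = subst (_≤ n) (sym (m+[n∸m]≡n (<⇒≤ lo<t))) (≤-trans (<⇒≤ t<lo+m) lo+m≤n)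
  count-first : ∀ t → Count n m (good lo (suc m) ∘ (t ∷_)) ≡ firstLetterCount lo m t
  count-first t =
    Count-dec m (t ≟ lo) (λ _ → count-good (suc lo) m (subst (_≤ n) (+-suc lo m) lo+m<n)) λ _ →
    Count-dec m (t ≟ lo + m) (λ _ → count-good lo m lo+m≤n) λ _ →
    Count-dec m (lo <? t ×-dec t <? lo + m) (λ (lo<t , t<lo+m) → count-interior t lo<t t<lo+m) λ _ →
    Count-zero m

interior-closed : ∀ j → interior j + 1 ≡ 2 ^ j
interior-closed zero    = refl
interior-closed (suc j) = begin
  (2 ^ j + interior j) + 1  ≡⟨ +-assoc (2 ^ j) (interior j) 1 ⟩
  2 ^ j + (interior j + 1)  ≡⟨ cong (2 ^ j +_) (interior-closed j) ⟩
  2 ^ j + 2 ^ j             ≡⟨ cong (2 ^ j +_) (sym (+-identityʳ (2 ^ j))) ⟩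
  2 ^ suc j                 ∎
  where open ≡-Reasoning

avoiders-closed : ∀ m → avoiders (suc m) ≡ m * 2 ^ (m ∸ 1) + 1
avoiders-closed zero          = refl
avoiders-closed (suc zero)    = refl
avoiders-closed (suc (suc i)) = begin
  avoiders (suc (suc i)) + avoiders (suc (suc i)) + interior (suc i)
    ≡⟨ cong (λ a → a + a + interior (suc i)) (avoiders-closed (suc i)) ⟩
  (suc i * P + 1) + (suc i * P + 1) + interior (suc i)  ≡⟨ regroup i P (interior (suc i)) ⟩
  suc i * (2 * P) + 1 + (interior (suc i) + 1)          ≡⟨ cong (suc i * (2 * P) + 1 +_) (interior-closed (suc i)) ⟩
  suc i * (2 * P) + 1 + 2 * P                           ≡⟨ collect i P ⟩
  suc (suc i) * (2 * P) + 1                             ∎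
  where
  open ≡-Reasoning
  open import Data.Nat.Tactic.RingSolver using (solve-∀)
  P = 2 ^ i
  regroup : ∀ i P I → (suc i * P + 1) + (suc i * P + 1) + I ≡ suc i * (2 * P) + 1 + (I + 1)
  regroup = solve-∀
  collect : ∀ i P → suc i * (2 * P) + 1 + 2 * P ≡ suc (suc i) * (2 * P) + 1
  collect = solve-∀

NoDescentBelow : ℕ → List ℕ → Set
NoDescentBelow x []          = ⊤
NoDescentBelow x (_ ∷ [])    = ⊤
NoDescentBelow x (a ∷ b ∷ w) = ¬ (b < a × a < x) × NoDescentBelow x (b ∷ w)

-- x, placed in front of w, is not the "2" of an occurrence of 2-1-3.
No213After : ℕ → List ℕ → Set
No213After x []      = ⊤
No213After x (y ∷ w) = (y < x → All (λ z → ¬ x < z) w) × No213After x w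

-- x, placed in front of w, is not the "3" of an occurrence of 34-21.
No3421After : ℕ → List ℕ → Set
No3421After x []      = ⊤
No3421After x (y ∷ w) = x < y → NoDescentBelow x w

-- w avoids 2-1-3 and 34-21: no letter starts an occurrence as its "2", resp. its "3".
Avoids : List ℕ → Set
Avoids []      = ⊤
Avoids (x ∷ w) = No213After x w × No3421After x w × Avoids w

NoDescentBelow-tail : ∀ {x y w} → NoDescentBelow x (y ∷ w) → NoDescentBelow x w
NoDescentBelow-tail {w = []}    _       = tt
NoDescentBelow-tail {w = _ ∷ _} (_ , r) = r

NoDescentBelow-cons≥ : ∀ {x y w} → x ≤ y → NoDescentBelow x w → NoDescentBelow x (y ∷ w)
NoDescentBelow-cons≥ {w = []}    _   _ = tt
NoDescentBelow-cons≥ {w = _ ∷ _} x≤y r = (λ (_ , y<x) → <⇒≱ y<x x≤y) , r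

NoDescentBelow-cons< : ∀ {x y w} → All (y <_) w → NoDescentBelow x w → NoDescentBelow x (y ∷ w)
NoDescentBelow-cons< []        _ = tt
NoDescentBelow-cons< (y<z ∷ _) r = (λ (z<y , _) → <-asym y<z z<y) , r

NoDescentBelow-above : ∀ {x w} → All (x ≤_) w → NoDescentBelow x w
NoDescentBelow-above []          = tt
NoDescentBelow-above (x≤y ∷ x≤w) = NoDescentBelow-cons≥ x≤y (NoDescentBelow-above x≤w)

NoDescentBelow⇒No3421After : ∀ {x w} → NoDescentBelow x w → No3421After x w
NoDescentBelow⇒No3421After {w = []}    _  = tt
NoDescentBelow⇒No3421After {w = _ ∷ _} nd _ = NoDescentBelow-tail nd

No213After-above : ∀ {x w} → All (x <_) w → No213After x w
No213After-above []            = tt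
No213After-above (x<y ∷ x<w) = (λ y<x → ⊥-elim (<-asym x<y y<x)) , No213After-above x<w

No213After-below : ∀ {x w} → All (_< x) w → No213After x w
No213After-below []          = tt
No213After-below (_ ∷ w<x) = (λ _ → All.map (λ z<x x<z → <-asym z<x x<z) w<x) , No213After-below w<x

No3421After-below : ∀ {x w} → All (_< x) w → No3421After x w
No3421After-below []            = tt
No3421After-below (y<x ∷ _) x<y = ⊥-elim (<-asym y<x x<y)

Between : ℕ → ℕ → ℕ → Set
Between lo hi e = lo ≤ e × e < hi

InBlocks : ℕ → ℕ → ℕ → ℕ → ℕ → Set
InBlocks a p lo q e = Between a (a + p) e ⊎ Between lo (lo + q) e

branch : ∀ {P : Set} (P? : Dec P) {X Y : ℕ} → (if does P? then X else Y) ≡ 1 → (P × X ≡ 1) ⊎ (¬ P × Y ≡ 1)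
branch (yes p) eq = inj₁ (p , eq)
branch (no ¬p) eq = inj₂ (¬p , eq)

Between-drop-min : ∀ {lo m e} → Between (suc lo) (suc lo + m) e → Between lo (lo + suc m) e
Between-drop-min {lo} {m} {e} (lo<e , e<) = <⇒≤ lo<e , subst (e <_) (sym (+-suc lo m)) e<

ascending-sound : ∀ lo q w → ascending lo q w ≡ 1 →
  Unique w × Avoids w × All (Between lo (lo + q)) w × (∀ x → NoDescentBelow x w)
ascending-sound lo zero    []      _ = [] , tt , [] , λ _ → tt
ascending-sound lo zero    (_ ∷ _) ()
ascending-sound lo (suc q) []      ()
ascending-sound lo (suc q) (y ∷ w) eq with branch (y ≟ lo) eq
... | inj₂ (_ , ())
... | inj₁ (refl , eq′) with ascending-sound (suc y) q w eq′
... | unique , avoids , inside , noDesc =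
  All.map (<⇒≢ ∘ proj₁) inside ∷ unique ,
  (No213After-above (All.map proj₁ inside) , NoDescentBelow⇒No3421After (noDesc y) , avoids) ,
  (≤-refl , m<m+n y z<s) ∷ All.map Between-drop-min inside ,
  λ x → NoDescentBelow-cons< (All.map proj₁ inside) (noDesc x)

-- The invariant satisfied by the words accepted by `minMax a p lo q` (with lo + q ≤ a):
-- besides being distinct, avoiding and inside the blocks, they can follow any letter x
-- between the blocks without creating a 2-1-3 or a descent below x.
record MinMaxShape (a p lo q : ℕ) (w : List ℕ) : Set where
  field
    unique   : Unique w
    avoids   : Avoids w
    inBlocks : All (InBlocks a p lo q) w
    no213    : ∀ x → lo + q ≤ x → x ≤ a → No213After x w
    noDesc   : ∀ x → x ≤ a → NoDescentBelow x w

lower-block-shape : ∀ {a lo q w} → Unique w × Avoids w × All (Between lo (lo + q)) w × (∀ x → NoDescentBelow x w) →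
  MinMaxShape a 0 lo q w
lower-block-shape (unique , avoids , inside , noDesc) = record
  { unique   = unique
  ; avoids   = avoids
  ; inBlocks = All.map inj₂ inside
  ; no213    = λ x lo+q≤x _ → No213After-below (All.map (λ (_ , e<) → <-≤-trans e< lo+q≤x) inside)
  ; noDesc   = λ x _ → noDesc x
  }

take-min-shape : ∀ {a p lo q w} → lo + q ≤ a → MinMaxShape (suc a) p lo q w → MinMaxShape a (suc p) lo q (a ∷ w)
take-min-shape {a} {p} {lo} {q} lo+q≤a shape = record
  { unique   = All.map a-fresh inBlocks ∷ unique
  ; avoids   = no213 a lo+q≤a (n≤1+n a) , NoDescentBelow⇒No3421After (noDesc a (n≤1+n a)) , avoids
  ; inBlocks = inj₁ (≤-refl , m<m+n a z<s) ∷ All.map widen inBlocks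
  ; no213    = λ x lo+q≤x x≤a → (λ a<x → ⊥-elim (<⇒≱ a<x x≤a)) , no213 x lo+q≤x (≤-trans x≤a (n≤1+n a))
  ; noDesc   = λ x x≤a → NoDescentBelow-cons≥ x≤a (noDesc x (≤-trans x≤a (n≤1+n a)))
  }
  where
  open MinMaxShape shape
  a-fresh : ∀ {e} → InBlocks (suc a) p lo q e → a ≢ e
  a-fresh (inj₁ (a<e , _)) = <⇒≢ a<e
  a-fresh (inj₂ (_ , e<))  = >⇒≢ (<-≤-trans e< lo+q≤a)
  widen : ∀ {e} → InBlocks (suc a) p lo q e → InBlocks a (suc p) lo q e
  widen (inj₁ upper) = inj₁ (Between-drop-min upper)
  widen (inj₂ lower) = inj₂ lower

take-max-shape : ∀ {a p lo q w} → lo + q ≤ a → MinMaxShape a (suc p) lo q w →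
  MinMaxShape a (suc (suc p)) lo q (a + suc p ∷ w)
take-max-shape {a} {p} {lo} {q} {w} lo+q≤a shape = record
  { unique   = All.map >⇒≢ below ∷ unique
  ; avoids   = No213After-below below , No3421After-below below , avoids
  ; inBlocks = inj₁ (m≤m+n a (suc p) , max<) ∷ All.map widen inBlocks
  ; no213    = λ x lo+q≤x x≤a → (λ c<x → ⊥-elim (<⇒≱ c<x (≤-trans x≤a a≤c))) , no213 x lo+q≤x x≤a
  ; noDesc   = λ x x≤a → NoDescentBelow-cons≥ (≤-trans x≤a a≤c) (noDesc x x≤a)
  }
  where
  open MinMaxShape shape
  a≤c : a ≤ a + suc p
  a≤c = m≤m+n a (suc p)
  max< : a + suc p < a + suc (suc p)
  max< = +-monoʳ-< a (n<1+n (suc p))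
  below : All (_< a + suc p) w
  below = All.map (λ { (inj₁ (_ , e<)) → e< ; (inj₂ (_ , e<)) → <-≤-trans e< (≤-trans lo+q≤a a≤c) }) inBlocks
  widen : ∀ {e} → InBlocks a (suc p) lo q e → InBlocks a (suc (suc p)) lo q e
  widen (inj₁ (a≤e , e<)) = inj₁ (a≤e , <-trans e< max<)
  widen (inj₂ lower)      = inj₂ lower

minMax-sound : ∀ a p lo q w → lo + q ≤ a → minMax a p lo q w ≡ 1 → MinMaxShape a p lo q w
minMax-sound a zero lo q w _ eq = lower-block-shape (ascending-sound lo q w eq)
minMax-sound a (suc p) lo q [] _ ()
minMax-sound a (suc zero) lo q (y ∷ w) lo+q≤a eq with branch (y ≟ a) eq
... | inj₂ (_ , ())
... | inj₁ (refl , eq′) = take-min-shape lo+q≤a (minMax-sound (suc a) zero lo q w (≤-trans lo+q≤a (n≤1+n a)) eq′)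
minMax-sound a (suc (suc p)) lo q (y ∷ w) lo+q≤a eq with branch (y ≟ a) eq
... | inj₁ (refl , eq′) = take-min-shape lo+q≤a (minMax-sound (suc a) (suc p) lo q w (≤-trans lo+q≤a (n≤1+n a)) eq′)
... | inj₂ (_ , eq₁) with branch (y ≟ a + suc p) eq₁
...   | inj₁ (refl , eq′) = take-max-shape lo+q≤a (minMax-sound a (suc p) lo q w lo+q≤a eq′)
...   | inj₂ (_ , ())

good-sound : ∀ lo m w → good lo m w ≡ 1 → Unique w × Avoids w × All (Between lo (lo + m)) w
good-sound lo zero    []      _ = [] , tt , []
good-sound lo zero    (_ ∷ _) ()
good-sound lo (suc m) []      ()
good-sound lo (suc m) (x ∷ w) eq with branch (x ≟ lo) eq
... | inj₁ (refl , eq′) with good-sound (suc x) m w eq′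
...   | unique , avoids , inside =
  All.map (<⇒≢ ∘ proj₁) inside ∷ unique ,
  (No213After-above (All.map proj₁ inside) ,
   NoDescentBelow⇒No3421After (NoDescentBelow-above (All.map (<⇒≤ ∘ proj₁) inside)) , avoids) ,
  (≤-refl , m<m+n x z<s) ∷ All.map Between-drop-min inside
good-sound lo (suc m) (x ∷ w) eq | inj₂ (_ , eq₁) with branch (x ≟ lo + m) eq₁
... | inj₁ (refl , eq′) with good-sound lo m w eq′
...   | unique , avoids , inside =
  All.map (>⇒≢ ∘ proj₂) inside ∷ unique ,
  (No213After-below (All.map proj₂ inside) , No3421After-below (All.map proj₂ inside) , avoids) ,
  (m≤m+n lo m , max<) ∷ All.map (λ (lo≤e , e<) → lo≤e , <-trans e< max<) inside
  where
  max< : lo + m < lo + suc m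
  max< = +-monoʳ-< lo (n<1+n m)
good-sound lo (suc m) (x ∷ w) eq | inj₂ (_ , eq₁) | inj₂ (_ , eq₂)
  with branch (lo <? x ×-dec x <? lo + m) eq₂
... | inj₂ (_ , ())
... | inj₁ ((lo<x , x<lo+m) , eq′) =
  All.map x-fresh inBlocks ∷ unique ,
  (no213 x (≤-reflexive lo+q≡x) (n≤1+n x) , NoDescentBelow⇒No3421After (noDesc x (n≤1+n x)) , avoids) ,
  (<⇒≤ lo<x , <-trans x<lo+m max<) ∷ All.map inWindow inBlocks
  where
  max< : lo + m < lo + suc m
  max< = +-monoʳ-< lo (n<1+n m)
  lo+q≡x : lo + (x ∸ lo) ≡ x
  lo+q≡x = m+[n∸m]≡n (<⇒≤ lo<x)
  open MinMaxShape (minMax-sound (suc x) (lo + m ∸ x) lo (x ∸ lo) w (≤-trans (≤-reflexive lo+q≡x) (n≤1+n x)) eq′)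
  x-fresh : ∀ {e} → InBlocks (suc x) (lo + m ∸ x) lo (x ∸ lo) e → x ≢ e
  x-fresh (inj₁ (x<e , _)) = <⇒≢ x<e
  x-fresh (inj₂ (_ , e<))  = >⇒≢ (subst (_ <_) lo+q≡x e<)
  inWindow : ∀ {e} → InBlocks (suc x) (lo + m ∸ x) lo (x ∸ lo) e → Between lo (lo + suc m) e
  inWindow {e} (inj₁ (x<e , e<)) = <⇒≤ (<-trans lo<x x<e) , subst (e <_) (window-above (<⇒≤ x<lo+m)) e<
  inWindow {e} (inj₂ (lo≤e , e<)) = lo≤e , <-trans (subst (e <_) lo+q≡x e<) (<-trans x<lo+m max<)

take-yes : ∀ {P : Set} (P? : Dec P) {X Y : ℕ} → P → X ≡ 1 → (if does P? then X else Y) ≡ 1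
take-yes P? p X≡1 rewrite dec-true P? p = X≡1

take-no : ∀ {P : Set} (P? : Dec P) {X Y : ℕ} → ¬ P → Y ≡ 1 → (if does P? then X else Y) ≡ 1
take-no P? ¬p Y≡1 rewrite dec-false P? ¬p = Y≡1

record Arrangement (R : ℕ → Set) (w : List ℕ) : Set where
  field
    distinct : Unique w
    inside   : All R w
    covers   : ∀ e → R e → e ∈ w

arrangement-tail : ∀ {R R′ : ℕ → Set} {y w} →
  (∀ {e} → R′ e → R e × e ≢ y) → (∀ {e} → R e → e ≢ y → R′ e) →
  Arrangement R (y ∷ w) → Arrangement R′ w
arrangement-tail to from record { distinct = y∉w ∷ distinct ; inside = _ ∷ inside ; covers = covers } = record
  { distinct = distinct
  ; inside   = All.zipWith (λ (r , y≢e) → from r (≢-sym y≢e)) (inside , y∉w)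
  ; covers   = λ e r′ → let (r , e≢y) = to r′ in Any.tail e≢y (covers e r)
  }

arrangement-drop-min : ∀ {lo q y w} → y ≡ lo → Arrangement (Between lo (lo + suc q)) (y ∷ w) →
  Arrangement (Between (suc lo) (suc lo + q)) w
arrangement-drop-min {lo} {q} refl = arrangement-tail (λ e∈ → Between-drop-min e∈ , >⇒≢ (proj₁ e∈))
  (λ {e} (lo≤e , e<) e≢lo → ≤∧≢⇒< lo≤e (≢-sym e≢lo) , subst (e <_) (+-suc lo q) e<)

arrangement-drop-max : ∀ {lo q y w} → y ≡ lo + q → Arrangement (Between lo (lo + suc q)) (y ∷ w) →
  Arrangement (Between lo (lo + q)) w
arrangement-drop-max {lo} {q} refl = arrangement-tail
  (λ (lo≤e , e<) → (lo≤e , <-trans e< (+-monoʳ-< lo (n<1+n q))) , <⇒≢ e<)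
  (λ {e} (lo≤e , e<) e≢max → lo≤e , ≤∧≢⇒< (≤-pred (subst (e <_) (+-suc lo q) e<)) e≢max)

upper-drop-min : ∀ {a p lo q y w} → lo + q < a → y ≡ a → Arrangement (InBlocks a (suc p) lo q) (y ∷ w) →
  Arrangement (InBlocks (suc a) p lo q) w
upper-drop-min {a} {p} {lo} {q} lo+q<a refl = arrangement-tail to from
  where
  to : ∀ {e} → InBlocks (suc a) p lo q e → InBlocks a (suc p) lo q e × e ≢ a
  to (inj₁ upper)     = inj₁ (Between-drop-min upper) , >⇒≢ (proj₁ upper)
  to (inj₂ (lo≤e , e<)) = inj₂ (lo≤e , e<) , <⇒≢ (<-trans e< lo+q<a)
  from : ∀ {e} → InBlocks a (suc p) lo q e → e ≢ a → InBlocks (suc a) p lo q e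
  from {e} (inj₁ (a≤e , e<)) e≢a = inj₁ (≤∧≢⇒< a≤e (≢-sym e≢a) , subst (e <_) (+-suc a p) e<)
  from (inj₂ lower)      _   = inj₂ lower

upper-drop-max : ∀ {a p lo q y w} → lo + q < a → y ≡ a + suc p → Arrangement (InBlocks a (suc (suc p)) lo q) (y ∷ w) →
  Arrangement (InBlocks a (suc p) lo q) w
upper-drop-max {a} {p} {lo} {q} lo+q<a refl = arrangement-tail to from
  where
  to : ∀ {e} → InBlocks a (suc p) lo q e → InBlocks a (suc (suc p)) lo q e × e ≢ a + suc p
  to (inj₁ (a≤e , e<))  = inj₁ (a≤e , <-trans e< (+-monoʳ-< a (n<1+n (suc p)))) , <⇒≢ e<
  to (inj₂ (lo≤e , e<)) = inj₂ (lo≤e , e<) , <⇒≢ (<-trans e< (<-≤-trans lo+q<a (m≤m+n a (suc p))))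
  from : ∀ {e} → InBlocks a (suc (suc p)) lo q e → e ≢ a + suc p → InBlocks a (suc p) lo q e
  from {e} (inj₁ (a≤e , e<)) e≢max = inj₁ (a≤e , ≤∧≢⇒< (≤-pred (subst (e <_) (+-suc a (suc p)) e<)) e≢max)
  from (inj₂ lower)      _     = inj₂ lower

arrangement-split : ∀ {lo m x w} → lo < x → x < lo + m → Arrangement (Between lo (lo + suc m)) (x ∷ w) →
  Arrangement (InBlocks (suc x) (lo + m ∸ x) lo (x ∸ lo)) w
arrangement-split {lo} {m} {x} lo<x x<lo+m = arrangement-tail to from
  where
  lo+q≡x : lo + (x ∸ lo) ≡ x
  lo+q≡x = m+[n∸m]≡n (<⇒≤ lo<x)
  above≡ : suc x + (lo + m ∸ x) ≡ lo + suc m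
  above≡ = window-above (<⇒≤ x<lo+m)
  to : ∀ {e} → InBlocks (suc x) (lo + m ∸ x) lo (x ∸ lo) e → Between lo (lo + suc m) e × e ≢ x
  to {e} (inj₁ (x<e , e<))  = (<⇒≤ (<-trans lo<x x<e) , subst (e <_) above≡ e<) , >⇒≢ x<e
  to {e} (inj₂ (lo≤e , e<)) = (lo≤e , <-trans (subst (e <_) lo+q≡x e<) (<-trans x<lo+m (+-monoʳ-< lo (n<1+n m))))
                        , <⇒≢ (subst (e <_) lo+q≡x e<)
  from : ∀ {e} → Between lo (lo + suc m) e → e ≢ x → InBlocks (suc x) (lo + m ∸ x) lo (x ∸ lo) e
  from {e} (lo≤e , e<) e≢x with <-cmp e x
  ... | tri< e<x _ _ = inj₂ (lo≤e , subst (e <_) (sym lo+q≡x) e<x)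
  ... | tri≈ _ e≡x _ = ⊥-elim (e≢x e≡x)
  ... | tri> _ _ x<e = inj₁ (x<e , subst (e <_) (sym above≡) e<)

arrangement-lower : ∀ {a lo q w} → Arrangement (InBlocks a 0 lo q) w → Arrangement (Between lo (lo + q)) w
arrangement-lower {a} record { distinct = distinct ; inside = inside ; covers = covers } = record
  { distinct = distinct
  ; inside   = All.map lower inside
  ; covers   = λ e e∈ → covers e (inj₂ e∈)
  }
  where
  lower : ∀ {lo q e} → InBlocks a 0 lo q e → Between lo (lo + q) e
  lower (inj₁ (a≤e , e<a)) = ⊥-elim (<⇒≱ e<a (subst (_≤ _) (sym (+-identityʳ a)) a≤e))
  lower (inj₂ lower)       = lower

ascending-from : ∀ {x y} r → NoDescentBelow x (y ∷ r) → y < x → All (_< x) r → All (y ≤_) r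
ascending-from []      _          _   _          = []
ascending-from (z ∷ r) (¬desc , nd) y<x (z<x ∷ r<x) = y≤z ∷ All.map (≤-trans y≤z) (ascending-from r nd z<x r<x)
  where
  y≤z = ≮⇒≥ (λ z<y → ¬desc (z<y , y<x))

strictly-below : ∀ {y r} → All (λ z → ¬ y < z) r → All (y ≢_) r → All (_< y) r
strictly-below y≮r y≢r = All.zipWith (λ (y≮z , y≢z) → ≤∧≢⇒< (≮⇒≥ y≮z) (≢-sym y≢z)) (y≮r , y≢r)

-- A value b with x < b < y followed later by a value l < x forces a 2-1-3 (with x as "2")
-- or, since everything after b stays below y, a descent below y.
no-drop-below : ∀ {x y b l} s → No213After x s → No213After y s → NoDescentBelow y s → All (y ≢_) s →
  b ∈ s → x < b → b < y → l ∈ s → l < x → ⊥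
no-drop-below [] _ _ _ _ () _ _ _ _
no-drop-below (c ∷ r) _ _ _ _ (here refl) x<b _ (here refl) l<x = <-asym x<b l<x
no-drop-below (c ∷ r) _ (y≮r , _) nd (_ ∷ y∉r) (here refl) x<b b<y (there l∈r) l<x =
  <⇒≱ (<-trans l<x x<b) (All.lookup (ascending-from r nd b<y (strictly-below (y≮r b<y) y∉r)) l∈r)
no-drop-below (c ∷ r) (x≮r , _) _ _ _ (there b∈r) x<b _ (here refl) l<x = All.lookup (x≮r l<x) b∈r x<b
no-drop-below (c ∷ r) (_ , no213x) (_ , no213y) nd (_ ∷ y∉r) (there b∈r) x<b b<y (there l∈r) l<x =
  no-drop-below r no213x no213y (NoDescentBelow-tail nd) y∉r b∈r x<b b<y l∈r l<x

-- In an avoiding word that later contains the values l < x < a < y < c, the letter y cannot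
-- come first: the next letter z either starts a 2-1-3 (y, z, c) or, being above y, starts a
-- 34-21 with a drop below y which `no-drop-below` excludes.
interior-first-impossible : ∀ {x y a c l} w → Unique (y ∷ w) → Avoids (y ∷ w) → No213After x w →
  c ∈ w → a ∈ w → l ∈ w → x < a → a < y → y < c → l < x → ⊥
interior-first-impossible [] _ _ _ () _ _ _ _ _ _
interior-first-impossible {y = y} (z ∷ w) (y∉zw ∷ _) (no213y , no3421y , _) (_ , no213x) c∈ a∈ l∈ x<a a<y y<c l<x
  with <-cmp y z
... | tri≈ _ y≡z _ = All.head y∉zw y≡z
... | tri> _ _ z<y = All.lookup (proj₁ no213y z<y) (Any.tail (λ c≡z → <-asym (subst (_< y) (sym c≡z) z<y) y<c) c∈) y<c
... | tri< y<z _ _ =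
  no-drop-below w no213x (proj₂ no213y) (no3421y y<z) (All.tail y∉zw)
    (Any.tail (λ a≡z → <-asym (subst (y <_) (sym a≡z) y<z) a<y) a∈) x<a a<y
    (Any.tail (λ l≡z → <-asym (subst (y <_) (sym l≡z) y<z) (<-trans l<x (<-trans x<a a<y))) l∈) l<x

-- If some later letter exceeds x, the letter following x exceeds x as well (otherwise 2-1-3),
-- so 34-21 avoidance leaves no descent below x.
noDescent-after : ∀ {x top} w → top ∈ w → x < top → No213After x w → No3421After x w → All (x ≢_) w →
  NoDescentBelow x w
noDescent-after [] () _ _ _ _
noDescent-after {x} (z ∷ w) top∈ x<top (no213 , _) no3421 (x≢z ∷ _) with <-cmp x z
... | tri< x<z _ _ = NoDescentBelow-cons≥ (<⇒≤ x<z) (no3421 x<z)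
... | tri≈ _ x≡z _ = ⊥-elim (x≢z x≡z)
... | tri> _ _ z<x =
  ⊥-elim (All.lookup (no213 z<x) (Any.tail (λ top≡z → <-asym (subst (_< x) (sym top≡z) z<x) x<top) top∈) x<top)

ascending-complete : ∀ lo q x w → Arrangement (Between lo (lo + q)) w → lo + q ≤ x → NoDescentBelow x w →
  ascending lo q w ≡ 1
ascending-complete lo zero    x []      _ _ _ = refl
ascending-complete lo zero    x (y ∷ w) record { inside = (lo≤y , y<lo) ∷ _ } _ _ =
  ⊥-elim (<⇒≱ y<lo (subst (_≤ y) (sym (+-identityʳ lo)) lo≤y))
ascending-complete lo (suc q) x []      arr _ _ = case Arrangement.covers arr lo (≤-refl , m<m+n lo z<s) of λ ()
ascending-complete lo (suc q) x (y ∷ w) arr lo+q<x nd =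
  take-yes (y ≟ lo) y≡lo
    (ascending-complete (suc lo) q x w (arrangement-drop-min y≡lo arr) (subst (_≤ x) (+-suc lo q) lo+q<x)
      (NoDescentBelow-tail nd))
  where
  open Arrangement arr
  w<x : All (_< x) (y ∷ w)
  w<x = All.map (λ (_ , e<) → <-≤-trans e< lo+q<x) inside
  y≡lo : y ≡ lo
  y≡lo with covers lo (≤-refl , m<m+n lo z<s)
  ... | here lo≡y  = sym lo≡y
  ... | there lo∈w = ≤-antisym (All.lookup (ascending-from w nd (All.head w<x) (All.tail w<x)) lo∈w)
                               (proj₁ (All.head inside))

-- The first letter of an arrangement of the blocks lies in the upper block: a lower letter
-- y < x would be followed by the upper value a > x, an occurrence of 2-1-3 starting at x.
head-in-upper : ∀ {a p lo q y w} → lo + q < a → No213After (lo + q) (y ∷ w) →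
  Arrangement (InBlocks a (suc p) lo q) (y ∷ w) → Between a (a + suc p) y
head-in-upper x<a _ record { inside = inj₁ upper ∷ _ } = upper
head-in-upper {a} {lo = lo} {q} x<a (no213 , _) record { inside = inj₂ (_ , y<x) ∷ _ ; covers = covers } =
  ⊥-elim (All.lookup (no213 y<x) (Any.tail (λ a≡y → <-asym x<a (subst (_< lo + q) (sym a≡y) y<x))
                                            (covers a (inj₁ (≤-refl , m<m+n a z<s)))) x<a)

-- Completeness of `minMax`; here x = lo + q is the letter preceding w.
minMax-complete : ∀ a p lo q w → lo + q < a → 0 < q → Arrangement (InBlocks a p lo q) w → Avoids w →
  No213After (lo + q) w → NoDescentBelow (lo + q) w → minMax a p lo q w ≡ 1
minMax-complete a zero lo q w _ _ arr _ _ nd = ascending-complete lo q (lo + q) w (arrangement-lower arr) ≤-refl nd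
minMax-complete a (suc p) lo q [] _ _ arr _ _ _ = case Arrangement.covers arr a (inj₁ (≤-refl , m<m+n a z<s)) of λ ()
minMax-complete a (suc zero) lo q (y ∷ w) x<a q>0 arr (_ , _ , avoids) no213 nd =
  take-yes (y ≟ a) y≡a
    (minMax-complete (suc a) zero lo q w (<-trans x<a (n<1+n a)) q>0 (upper-drop-min x<a y≡a arr) avoids
      (proj₂ no213) (NoDescentBelow-tail nd))
  where
  y≡a : y ≡ a
  y≡a with head-in-upper x<a no213 arr
  ... | a≤y , y<a+1 = ≤-antisym (≤-pred (subst (y <_) (+-comm a 1) y<a+1)) a≤y
minMax-complete a (suc (suc p)) lo q (y ∷ w) x<a q>0 arr avoids@(_ , _ , avoids-w) no213 nd =
  by-cases (<-cmp y a) (<-cmp y c)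
  where
  open Arrangement arr
  c = a + suc p
  x = lo + q
  c<top : c < a + suc (suc p)
  c<top = +-monoʳ-< a (n<1+n (suc p))
  later : ∀ {e} → e ≢ y → InBlocks a (suc (suc p)) lo q e → e ∈ w
  later e≢y e∈ = Any.tail e≢y (covers _ e∈)
  by-cases : Tri (y < a) (y ≡ a) (a < y) → Tri (y < c) (y ≡ c) (c < y) → minMax a (suc (suc p)) lo q (y ∷ w) ≡ 1
  by-cases (tri≈ _ y≡a _) _ =
    take-yes (y ≟ a) y≡a
      (minMax-complete (suc a) (suc p) lo q w (<-trans x<a (n<1+n a)) q>0 (upper-drop-min x<a y≡a arr) avoids-w
        (proj₂ no213) (NoDescentBelow-tail nd))
  by-cases (tri> _ _ a<y) (tri≈ _ y≡c _) =
    take-no (y ≟ a) (>⇒≢ a<y) (take-yes (y ≟ c) y≡c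
      (minMax-complete a (suc p) lo q w x<a q>0 (upper-drop-max x<a y≡c arr) avoids-w
        (proj₂ no213) (NoDescentBelow-tail nd)))
  by-cases (tri> _ _ a<y) (tri< y<c _ _) = ⊥-elim (interior-first-impossible w distinct avoids (proj₂ no213)
    (later (>⇒≢ y<c) (inj₁ (m≤m+n a (suc p) , c<top)))
    (later (<⇒≢ a<y) (inj₁ (≤-refl , m<m+n a z<s)))
    (later (<⇒≢ (<-trans lo<x (<-trans x<a a<y))) (inj₂ (≤-refl , lo<x)))
    x<a a<y y<c lo<x)
    where
    lo<x : lo < x
    lo<x = m<m+n lo q>0
  by-cases (tri> _ _ a<y) (tri> _ _ c<y) =
    ⊥-elim (<⇒≱ c<y (≤-pred (subst (y <_) (+-suc a (suc p)) (proj₂ (head-in-upper x<a no213 arr)))))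
  by-cases (tri< y<a _ _) _ = ⊥-elim (<⇒≱ y<a (proj₁ (head-in-upper x<a no213 arr)))

good-complete : ∀ lo m w → Arrangement (Between lo (lo + m)) w → Avoids w → good lo m w ≡ 1
good-complete lo zero    []      _ _ = refl
good-complete lo zero    (x ∷ w) record { inside = (lo≤x , x<lo) ∷ _ } _ =
  ⊥-elim (<⇒≱ x<lo (subst (_≤ x) (sym (+-identityʳ lo)) lo≤x))
good-complete lo (suc m) []      arr _ = case Arrangement.covers arr lo (≤-refl , m<m+n lo z<s) of λ ()
good-complete lo (suc m) (x ∷ w) arr (no213 , no3421 , avoids) = by-cases (<-cmp x lo) (<-cmp x (lo + m))
  where
  open Arrangement arr
  max< : lo + m < lo + suc m
  max< = +-monoʳ-< lo (n<1+n m)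
  interior-complete : lo < x → x < lo + m → minMax (suc x) (lo + m ∸ x) lo (x ∸ lo) w ≡ 1
  interior-complete lo<x x<lo+m =
    minMax-complete (suc x) (lo + m ∸ x) lo (x ∸ lo) w (subst (_< suc x) (sym lo+q≡x) (n<1+n x)) (m<n⇒0<n∸m lo<x)
      (arrangement-split lo<x x<lo+m arr) avoids (subst (λ y → No213After y w) (sym lo+q≡x) no213)
      (subst (λ y → NoDescentBelow y w) (sym lo+q≡x)
        (noDescent-after w (Any.tail (>⇒≢ x<lo+m) (covers (lo + m) (m≤m+n lo m , max<))) x<lo+m no213 no3421
          (AllPairs.head distinct)))
    where
    lo+q≡x : lo + (x ∸ lo) ≡ x
    lo+q≡x = m+[n∸m]≡n (<⇒≤ lo<x)
  by-cases : Tri (x < lo) (x ≡ lo) (lo < x) → Tri (x < lo + m) (x ≡ lo + m) (lo + m < x) → good lo (suc m) (x ∷ w) ≡ 1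
  by-cases (tri≈ _ x≡lo _) _ =
    take-yes (x ≟ lo) x≡lo (good-complete (suc lo) m w (arrangement-drop-min x≡lo arr) avoids)
  by-cases (tri> _ _ lo<x) (tri≈ _ x≡max _) =
    take-no (x ≟ lo) (>⇒≢ lo<x)
      (take-yes (x ≟ lo + m) x≡max (good-complete lo m w (arrangement-drop-max x≡max arr) avoids))
  by-cases (tri> _ _ lo<x) (tri< x<max _ _) =
    take-no (x ≟ lo) (>⇒≢ lo<x) (take-no (x ≟ lo + m) (<⇒≢ x<max)
      (take-yes (lo <? x ×-dec x <? lo + m) (lo<x , x<max) (interior-complete lo<x x<max)))
  by-cases (tri> _ _ lo<x) (tri> _ _ max<x) =
    ⊥-elim (<⇒≱ max<x (≤-pred (subst (x <_) (+-suc lo m) (proj₂ (All.head inside)))))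
  by-cases (tri< x<lo _ _) _ = ⊥-elim (<⇒≱ x<lo (proj₁ (All.head inside)))

if-≤1 : ∀ (b : Bool) {X Y : ℕ} → X ≤ 1 → Y ≤ 1 → (if b then X else Y) ≤ 1
if-≤1 true  X≤1 _   = X≤1
if-≤1 false _   Y≤1 = Y≤1

ascending-≤1 : ∀ lo q w → ascending lo q w ≤ 1
ascending-≤1 lo zero    []      = ≤-refl
ascending-≤1 lo zero    (_ ∷ _) = z≤n
ascending-≤1 lo (suc q) []      = z≤n
ascending-≤1 lo (suc q) (t ∷ w) = if-≤1 (does (t ≟ lo)) (ascending-≤1 (suc lo) q w) z≤n

minMax-≤1 : ∀ a p lo q w → minMax a p lo q w ≤ 1
minMax-≤1 a zero          lo q w       = ascending-≤1 lo q w
minMax-≤1 a (suc p)       lo q []      = z≤n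
minMax-≤1 a (suc zero)    lo q (t ∷ w) = if-≤1 (does (t ≟ a)) (ascending-≤1 lo q w) z≤n
minMax-≤1 a (suc (suc p)) lo q (t ∷ w) =
  if-≤1 (does (t ≟ a)) (minMax-≤1 (suc a) (suc p) lo q w)
    (if-≤1 (does (t ≟ a + suc p)) (minMax-≤1 a (suc p) lo q w) z≤n)

good-≤1 : ∀ lo m w → good lo m w ≤ 1
good-≤1 lo zero    []      = ≤-refl
good-≤1 lo zero    (_ ∷ _) = z≤n
good-≤1 lo (suc m) []      = z≤n
good-≤1 lo (suc m) (t ∷ w) =
  if-≤1 (does (t ≟ lo)) (good-≤1 (suc lo) m w)
    (if-≤1 (does (t ≟ lo + m)) (good-≤1 lo m w)
      (if-≤1 (does (lo <? t ×-dec t <? lo + m)) (minMax-≤1 (suc t) (lo + m ∸ t) lo (t ∸ lo) w) z≤n))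

injective⇒surjective : ∀ {m} (f : Fin m → Fin m) → (∀ i j → f i ≡ f j → i ≡ j) → ∀ y → ∃ λ i → f i ≡ y
injective⇒surjective {suc m} f injective y with FinP.any? (λ i → f i FinP.≟ y)
... | yes hit  = hit
... | no  miss = ⊥-elim (no-collision (FinP.pigeonhole (n<1+n m) squeeze))
  where
  y≢f : ∀ i → y ≢ f i
  y≢f i y≡fi = miss (i , sym y≡fi)
  -- Missing y, the map f squeezes Fin (m+1) into Fin m.
  squeeze : Fin (suc m) → Fin m
  squeeze i = Fin.punchOut (y≢f i)
  no-collision : (∃₂ λ i j → i Fin.< j × squeeze i ≡ squeeze j) → ⊥
  no-collision (i , j , i<j , same) =
    <-irrefl (cong toℕ (injective i j (FinP.punchOut-injective (y≢f i) (y≢f j) same))) i<j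

module WordPredicates {n : ℕ} where

  InjectiveWord : ∀ {k} → Vec (Fin n) k → Set
  InjectiveWord {k} v = ∀ (i j : Fin k) → lookup v i ≡ lookup v j → i ≡ j

  Avoids213Word : ∀ {k} → Vec (Fin n) k → Set
  Avoids213Word {k} v = ∀ (i j l : Fin k) → i Fin.< j → j Fin.< l →
    ¬ (lookup v j Fin.< lookup v i × lookup v i Fin.< lookup v l)

  Avoids3421Word : ∀ {k} → Vec (Fin n) k → Set
  Avoids3421Word {k} v = ∀ (i i′ l l′ : Fin k) →
    toℕ i′ ≡ suc (toℕ i) → toℕ l′ ≡ suc (toℕ l) → suc (toℕ i) < toℕ l →
    ¬ (lookup v l′ Fin.< lookup v l × lookup v l Fin.< lookup v i × lookup v i Fin.< lookup v i′)

  all-values : ∀ {P : ℕ → Set} {k} (v : Vec (Fin n) k) → (∀ i → P (toℕ (lookup v i))) → All P (values v)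
  all-values []      _   = []
  all-values (x ∷ v) all = all Fin.zero ∷ all-values v (all ∘ Fin.suc)

  lookup-values : ∀ {P : ℕ → Set} {k} (v : Vec (Fin n) k) → All P (values v) → ∀ i → P (toℕ (lookup v i))
  lookup-values (x ∷ v) (px ∷ _)   Fin.zero    = px
  lookup-values (x ∷ v) (_  ∷ pxs) (Fin.suc i) = lookup-values v pxs i

  ∈-values : ∀ {k} (v : Vec (Fin n) k) i → toℕ (lookup v i) ∈ values v
  ∈-values (x ∷ v) Fin.zero    = here refl
  ∈-values (x ∷ v) (Fin.suc i) = there (∈-values v i)

  injective⇒unique : ∀ {k} (v : Vec (Fin n) k) → InjectiveWord v → Unique (values v)
  injective⇒unique []      _         = []
  injective⇒unique (x ∷ v) injective =
    all-values v (λ i same → 0≢suc (injective Fin.zero (Fin.suc i) (FinP.toℕ-injective same))) ∷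
    injective⇒unique v (λ i j same → FinP.suc-injective (injective (Fin.suc i) (Fin.suc j) same))
    where
    0≢suc : ∀ {k} {i : Fin k} → Fin.zero ≢ Fin.suc i
    0≢suc ()

  unique⇒injective : ∀ {k} (v : Vec (Fin n) k) → Unique (values v) → InjectiveWord v
  unique⇒injective (x ∷ v) _             Fin.zero    Fin.zero    _    = refl
  unique⇒injective (x ∷ v) (x∉v ∷ _)     Fin.zero    (Fin.suc j) same = ⊥-elim (lookup-values v x∉v j (cong toℕ same))
  unique⇒injective (x ∷ v) (x∉v ∷ _)     (Fin.suc i) Fin.zero    same = ⊥-elim (lookup-values v x∉v i (cong toℕ (sym same)))
  unique⇒injective (x ∷ v) (_ ∷ unique) (Fin.suc i) (Fin.suc j) same = cong Fin.suc (unique⇒injective v unique i j same)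

  No213Before : ℕ → ∀ {k} → Vec (Fin n) k → Set
  No213Before t {k} v = ∀ (j l : Fin k) → j Fin.< l → ¬ (toℕ (lookup v j) < t × t < toℕ (lookup v l))

  No213Before⇒No213After : ∀ t {k} (v : Vec (Fin n) k) → No213Before t v → No213After t (values v)
  No213Before⇒No213After t []      _      = tt
  No213Before⇒No213After t (y ∷ v) no213 =
    (λ y<t → all-values v (λ l t<vl → no213 Fin.zero (Fin.suc l) z<s (y<t , t<vl))) ,
    No213Before⇒No213After t v (λ j l j<l → no213 (Fin.suc j) (Fin.suc l) (s≤s j<l))

  No213After⇒No213Before : ∀ t {k} (v : Vec (Fin n) k) → No213After t (values v) → No213Before t v
  No213After⇒No213Before t (y ∷ v) (y≮ , _) Fin.zero    (Fin.suc l) _         (y<t , t<vl) = lookup-values v (y≮ y<t) l t<vl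
  No213After⇒No213Before t (y ∷ v) (_ , no213) (Fin.suc j) (Fin.suc l) (s≤s j<l) occurrence =
    No213After⇒No213Before t v no213 j l j<l occurrence

  NoDescentBelowWord : ℕ → ∀ {k} → Vec (Fin n) k → Set
  NoDescentBelowWord t {k} v = ∀ (l l′ : Fin k) → toℕ l′ ≡ suc (toℕ l) →
    ¬ (toℕ (lookup v l′) < toℕ (lookup v l) × toℕ (lookup v l) < t)

  NoDescentBelowWord⇒ : ∀ t {k} (v : Vec (Fin n) k) → NoDescentBelowWord t v → NoDescentBelow t (values v)
  NoDescentBelowWord⇒ t []          _  = tt
  NoDescentBelowWord⇒ t (a ∷ [])    _  = tt
  NoDescentBelowWord⇒ t (a ∷ b ∷ v) nd =
    nd Fin.zero (Fin.suc Fin.zero) refl ,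
    NoDescentBelowWord⇒ t (b ∷ v) (λ l l′ next → nd (Fin.suc l) (Fin.suc l′) (cong suc next))

  ⇒NoDescentBelowWord : ∀ t {k} (v : Vec (Fin n) k) → NoDescentBelow t (values v) → NoDescentBelowWord t v
  ⇒NoDescentBelowWord t (a ∷ b ∷ v) (¬desc , _)  Fin.zero    (Fin.suc Fin.zero) refl = ¬desc
  ⇒NoDescentBelowWord t (a ∷ b ∷ v) (_ , nd) (Fin.suc l) (Fin.suc l′) next =
    ⇒NoDescentBelowWord t (b ∷ v) nd l l′ (suc-injective next)
  ⇒NoDescentBelowWord t (a ∷ [])     _ Fin.zero Fin.zero ()
  ⇒NoDescentBelowWord t (a ∷ b ∷ v)  _ Fin.zero Fin.zero ()
  ⇒NoDescentBelowWord t (a ∷ b ∷ v)  _ Fin.zero (Fin.suc (Fin.suc _)) ()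
  ⇒NoDescentBelowWord t (a ∷ b ∷ v)  _ (Fin.suc _) Fin.zero ()

  Avoids3421Word-cons : ∀ x {k} (v : Vec (Fin n) k) → No3421After (toℕ x) (values v) → Avoids3421Word v →
    Avoids3421Word (x ∷ v)
  Avoids3421Word-cons x (y ∷ v) no3421 _ Fin.zero (Fin.suc Fin.zero) (Fin.suc (Fin.suc l)) (Fin.suc (Fin.suc l′))
    _ next _ (desc , below , x<y) =
    ⇒NoDescentBelowWord (toℕ x) v (no3421 x<y) l l′ (suc-injective (suc-injective next)) (desc , below)
  Avoids3421Word-cons x v _ rest (Fin.suc i) (Fin.suc i′) (Fin.suc l) (Fin.suc l′) next-i next-l (s≤s i<l) occ =
    rest i i′ l l′ (suc-injective next-i) (suc-injective next-l) i<l occ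
  Avoids3421Word-cons x v _ _ Fin.zero Fin.zero _ _ () _ _ _
  Avoids3421Word-cons x v _ _ Fin.zero (Fin.suc (Fin.suc _)) _ _ () _ _ _
  Avoids3421Word-cons x v _ _ Fin.zero (Fin.suc Fin.zero) Fin.zero _ _ _ () _
  Avoids3421Word-cons x v _ _ Fin.zero (Fin.suc Fin.zero) (Fin.suc Fin.zero) _ _ _ (s≤s ()) _
  Avoids3421Word-cons x v _ _ Fin.zero (Fin.suc Fin.zero) (Fin.suc (Fin.suc _)) Fin.zero _ () _ _
  Avoids3421Word-cons x v _ _ Fin.zero (Fin.suc Fin.zero) (Fin.suc (Fin.suc _)) (Fin.suc Fin.zero) _ () _ _
  Avoids3421Word-cons x v _ _ (Fin.suc _) Fin.zero _ _ () _ _ _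
  Avoids3421Word-cons x v _ _ (Fin.suc _) (Fin.suc _) Fin.zero _ _ _ () _
  Avoids3421Word-cons x v _ _ (Fin.suc _) (Fin.suc _) (Fin.suc _) Fin.zero _ () _ _

  avoids⇒Avoids : ∀ {k} (v : Vec (Fin n) k) → Avoids213Word v → Avoids3421Word v → Avoids (values v)
  avoids⇒Avoids []      _    _     = tt
  avoids⇒Avoids (x ∷ v) a213 a3421 =
    No213Before⇒No213After (toℕ x) v (λ j l j<l → a213 Fin.zero (Fin.suc j) (Fin.suc l) z<s (s≤s j<l)) ,
    no3421 v a3421 ,
    avoids⇒Avoids v (λ i j l i<j j<l → a213 (Fin.suc i) (Fin.suc j) (Fin.suc l) (s≤s i<j) (s≤s j<l))
      (λ i i′ l l′ next-i next-l i<l →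
         a3421 (Fin.suc i) (Fin.suc i′) (Fin.suc l) (Fin.suc l′) (cong suc next-i) (cong suc next-l) (s≤s i<l))
    where
    no3421 : ∀ {k} (v : Vec (Fin n) k) → Avoids3421Word (x ∷ v) → No3421After (toℕ x) (values v)
    no3421 []      _     = tt
    no3421 (y ∷ v) a3421 x<y = NoDescentBelowWord⇒ (toℕ x) v (λ l l′ next (desc , below) →
      a3421 Fin.zero (Fin.suc Fin.zero) (Fin.suc (Fin.suc l)) (Fin.suc (Fin.suc l′)) refl (cong (suc ∘ suc) next)
        (s≤s (s≤s z≤n)) (desc , below , x<y))

  Avoids⇒avoids : ∀ {k} (v : Vec (Fin n) k) → Avoids (values v) → Avoids213Word v × Avoids3421Word v
  Avoids⇒avoids []      _                          = (λ ()) , (λ ())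
  Avoids⇒avoids (x ∷ v) (no213 , no3421 , avoids) = a213 , Avoids3421Word-cons x v no3421 rest3421
    where
    rest = Avoids⇒avoids v avoids
    rest3421 = proj₂ rest
    a213 : Avoids213Word (x ∷ v)
    a213 Fin.zero    (Fin.suc j) (Fin.suc l) _         (s≤s j<l) = No213After⇒No213Before (toℕ x) v no213 j l j<l
    a213 (Fin.suc i) (Fin.suc j) (Fin.suc l) (s≤s i<j) (s≤s j<l) = proj₁ rest i j l i<j j<l

open WordPredicates

avoider? : ∀ {n} (w : Word n) → Dec (IsPerm w × (Avoids-2-1-3 w × Avoids-34-21 w))
avoider? w = isPerm? w ×-dec (avoids-2-1-3? w ×-dec avoids-34-21? w)

-- Completeness and soundness of `good 0 n` for the words of Defs; a permutation of Fin n
-- lists every value, since an injective endomap of Fin n is surjective.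
avoider⇒good : ∀ {n} (w : Word n) → IsPerm w → Avoids-2-1-3 w → Avoids-34-21 w → good 0 n (values w) ≡ 1
avoider⇒good {n} w injective a213 a3421 = good-complete 0 n (values w) arrangement (avoids⇒Avoids w a213 a3421)
  where
  covered : ∀ e → e < n → e ∈ values w
  covered e e<n with injective⇒surjective (lookup w) injective (Fin.fromℕ< e<n)
  ... | i , wᵢ≡e = subst (_∈ values w) (trans (cong toℕ wᵢ≡e) (FinP.toℕ-fromℕ< e<n)) (∈-values w i)
  arrangement : Arrangement (Between 0 n) (values w)
  arrangement = record
    { distinct = injective⇒unique w injective
    ; inside   = all-values w (λ i → z≤n , FinP.toℕ<n (lookup w i))
    ; covers   = λ e (_ , e<n) → covered e e<n
    }

good⇒avoider : ∀ {n} (w : Word n) → good 0 n (values w) ≡ 1 → IsPerm w × (Avoids-2-1-3 w × Avoids-34-21 w)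
good⇒avoider {n} w accepted with good-sound 0 n (values w) accepted
... | unique , avoids , _ = unique⇒injective w unique , Avoids⇒avoids w avoids

indicator-good : ∀ {n} (w : Word n) → (if does (avoider? w) then 1 else 0) ≡ good 0 n (values w)
indicator-good {n} w = by-decision (avoider? w)
  where
  by-decision : (d : Dec (IsPerm w × (Avoids-2-1-3 w × Avoids-34-21 w))) →
    (if does d then 1 else 0) ≡ good 0 n (values w)
  by-decision (yes (injective , a213 , a3421)) = sym (avoider⇒good w injective a213 a3421)
  by-decision (no ¬avoider) =
    sym (n<1⇒n≡0 (≤∧≢⇒< (good-≤1 0 n (values w)) (¬avoider ∘ good⇒avoider w)))

count-avoiders : ∀ n → length (Av-2-1-3-34-21 n) ≡ avoiders n
count-avoiders n = trans (length-filter-Count avoider? (good 0 n) indicator-good) (count-good 0 n ≤-refl)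

corollary3p7 : (n : ℕ) → n ≥ 1 →
    length (Av-2-1-3-34-21 n) ≡ (n ∸ 1) * 2 ^ (n ∸ 2) + 1
corollary3p7 (suc m) _ = trans (count-avoiders (suc m)) (avoiders-closed m)
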